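{- For every positive integer $n$ with $n\notin\{4,8,12\}$, there does not exist a product design $PD\big(n;\ 1_{(3)};\ 1_{(3)};\ n-3\big)$.
   Context: An orthogonal design (OD) of order $n$ and type $(c_1,\ldots,c_k)$, written $OD(n;\ c_1,\ldots,c_k)$, is a square matrix $C$ of order $n$ with entries from $\{0,\pm x_1,\ldots,\pm x_k\}$, where the $x_j$ are commuting variables, such that $CC^{\rm T}=\big(\sum_{j=1}^k c_jx_j^2\big)I_n$. The notation $u_{(k)}$ means $u$ repeated $k$ times, so $1_{(3)}$ stands for $1,1,1$. The Hadamard product of two matrices $A=[a_{ij}]$, $B=[b_{ij}]$ of the same size is $A*B=[a_{ij}b_{ij}]$. Two square matrices $A,B$ are amicable if $AB^{\rm T}=BA^{\rm T}$. If $M_1$, $M_2$, $N$ are ODs of order $n$ and types $(a_1,\ldots,a_r)$, $(b_1,\ldots,b_s)$, $(u_1,\ldots,u_t)$ respectively, then $(M_1;M_2;N)$ is a product design $PD(n;\ a_1,\ldots,a_r;\ b_1,\ldots,b_s;\ u_1,\ldots,u_t)$ if (i) $M_1*N=M_2*N=\mathbf{0}$; (ii) $M_1+N$ and $M_2+N$ are ODs; (iii) $M_1M_2^{\rm T}=M_2M_1^{\rm T}$. -}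

module Defs where

open import Data.Nat using (ℕ; zero; suc) renaming (_+_ to _+ℕ_)
open import Data.Integer using (ℤ; +_; -_; _+_; _*_; 0ℤ)
open import Data.Fin using (Fin; zero; suc; _↑ˡ_; _↑ʳ_)
open import Data.Vec using (Vec; lookup; _++_)
open import Data.Product using (Σ; Σ-syntax; _×_)
open import Relation.Binary.PropositionalEquality using (_≡_)

∑ : ∀ {n} → (Fin n → ℤ) → ℤ
∑ {zero}  f = 0ℤ
∑ {suc n} f = f zero + ∑ (λ i → f (suc i))

data Entry (k : ℕ) : Set where
  zer : Entry k
  pos : Fin k → Entry k
  neg : Fin k → Entry k

⟦_⟧ : ∀ {k} → Entry k → (Fin k → ℤ) → ℤ
⟦ zer ⟧   x = 0ℤ
⟦ pos a ⟧ x = x a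
⟦ neg a ⟧ x = - x a

Mat : ℕ → ℕ → Set
Mat n k = Fin n → Fin n → Entry k

-- Square matrix of order n whose entries are polynomials over ℤ in k
-- commuting variables, represented by their polynomial functions
-- (faithful since ℤ is an infinite integral domain).
PolyMat : ℕ → ℕ → Set
PolyMat n k = Fin n → Fin n → (Fin k → ℤ) → ℤ

toPoly : ∀ {n k} → Mat n k → PolyMat n k
toPoly C i j = ⟦ C i j ⟧

δ : ∀ {n} → Fin n → Fin n → ℤ → ℤ
δ zero    zero    v = v
δ zero    (suc j) v = 0ℤ
δ (suc i) zero    v = 0ℤ
δ (suc i) (suc j) v = δ i j v

quadForm : ∀ {k} → Vec ℕ k → (Fin k → ℤ) → ℤ
quadForm c x = ∑ (λ a → + lookup c a * (x a * x a))

IsOD : ∀ {n k} → Mat n k → Vec ℕ k → Set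
IsOD {n} C c = ∀ (x : _) (i j : Fin n) →
  ∑ (λ l → ⟦ C i l ⟧ x * ⟦ C j l ⟧ x) ≡ δ i j (quadForm c x)

IsODPoly : ∀ {n k} → PolyMat n k → Vec ℕ k → Set
IsODPoly {n} {k} P c = Σ[ C ∈ Mat n k ]
  ((∀ i j x → ⟦ C i j ⟧ x ≡ P i j x) × IsOD C c)

-- M + N where M uses variables x_1..x_r and N uses (new) variables y_1..y_t;
-- the result is a polynomial matrix in the r + t variables x_1..x_r,y_1..y_t.
_⊕_ : ∀ {n r t} → Mat n r → Mat n t → PolyMat n (r +ℕ t)
_⊕_ {r = r} {t} M N i j v = ⟦ M i j ⟧ (λ a → v (a ↑ˡ t)) + ⟦ N i j ⟧ (λ b → v (r ↑ʳ b))

-- Product design PD(n; a_1..a_r; b_1..b_s; u_1..u_t).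
-- M₁, M₂, N have pairwise distinct sets of commuting variables.
record PD (n : ℕ) {r s t : ℕ} (a : Vec ℕ r) (b : Vec ℕ s) (u : Vec ℕ t) : Set where
  field
    M₁ : Mat n r
    M₂ : Mat n s
    N  : Mat n t
    M₁-OD : IsOD M₁ a
    M₂-OD : IsOD M₂ b
    N-OD  : IsOD N u
    hadamard₁ : ∀ i j x y → ⟦ M₁ i j ⟧ x * ⟦ N i j ⟧ y ≡ 0ℤ
    hadamard₂ : ∀ i j x y → ⟦ M₂ i j ⟧ x * ⟦ N i j ⟧ y ≡ 0ℤ
    sum₁-OD : IsODPoly (M₁ ⊕ N) (a ++ u)
    sum₂-OD : IsODPoly (M₂ ⊕ N) (b ++ u)
    amicable : ∀ x y (i j : Fin n) →
      ∑ (λ l → ⟦ M₁ i l ⟧ x * ⟦ M₂ j l ⟧ y) ≡ ∑ (λ l → ⟦ M₂ i l ⟧ y * ⟦ M₁ j l ⟧ x)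

-- Write A_a and B_b for M₁ and M₂ with x_a (resp. y_b) set to 1 and the other variables
-- to 0, and W for N with its variable set to 1.  Row weights force n ≥ 3, and M₁ + N at
-- all ones is a ±1 matrix with orthogonal rows, so 4 ∣ n.  Each A_a is a signed
-- permutation matrix.  Let π m be the column of x₁ in row m, and p m (resp. p₃ m) the row
-- whose x₁ lies in the column of x₂ (resp. x₃) of row m; polarising M₁M₁ᵀ shows that p is
-- a fixed-point-free involution.  N vanishes at (m, π m) by the Hadamard condition, so as
-- M₂ + N has no zero entry, some y_b (the colour of m) sits there; let σ_b m be the
-- product of the signs of y_b and x₁ at (m, π m).  Amicability gives σ_b (p m) = − σ_b m,
-- whereas polarising (M_j + N)(M_j + N)ᵀ gives σ_b i = σ_b m for rows i ≠ m of colour b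
-- with W i (π m) ≠ 0, i.e. with π m not a column of x₁, x₂, x₃ in row i.  Applied to m
-- and p m, this confines the colour class of i to {i, p i, p₃ i, p (p₃ i)}; hence
-- n ≤ 3 · 4 = 12, leaving no multiple of 4 but 4, 8, 12.

module Submission where

open import Defs
open import Data.Nat using (ℕ; zero; suc; _≤_; _∸_; z≤n; s≤s)
import Data.Nat as ℕ
import Data.Nat.Properties as ℕₚ
open import Data.Nat.Divisibility using (_∣_; divides; ∣m∣n⇒∣m+n; m∣m*n)
open import Data.Integer using (ℤ; +_; -_; 0ℤ; 1ℤ; -1ℤ; ∣_∣; _+_; _*_)
import Data.Integer.Properties as ℤₚ
open import Data.Integer.Tactic.RingSolver using (solve-∀)
open import Algebra.Properties.AbelianGroup ℤₚ.+-0-abelianGroup using (inverseˡ-unique)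
open import Data.Fin using (Fin; zero; suc; punchOut; combine; fromℕ<)
open import Data.Fin.Properties
  using (_≟_; any?; suc-injective; injective⇒≤; punchOut-injective; combine-injective)
open import Data.Vec using (Vec; _∷_; []; lookup)
open import Data.Vec.Functional using () renaming (_++_ to _⧺_)
open import Data.Vec.Functional.Properties using (lookup-++ˡ; lookup-++ʳ)
open import Data.Product using (∃; _×_; _,_; proj₁; proj₂)
open import Data.Sum using (_⊎_; inj₁; inj₂)
open import Data.Empty using (⊥; ⊥-elim)
open import Function using (_∘_)
open import Function.Definitions using (Injective)
open import Relation.Nullary using (¬_; Dec; yes; no)
open import Relation.Binary.PropositionalEquality

∑-cong : ∀ {n} {f g : Fin n → ℤ} → (∀ l → f l ≡ g l) → ∑ f ≡ ∑ g
∑-cong {zero}  f≗g = refl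
∑-cong {suc n} f≗g = cong₂ _+_ (f≗g zero) (∑-cong (f≗g ∘ suc))

∑-distrib-+ : ∀ {n} (f g : Fin n → ℤ) → ∑ (λ l → f l + g l) ≡ ∑ f + ∑ g
∑-distrib-+ {zero}  f g = refl
∑-distrib-+ {suc n} f g = begin
  (f zero + g zero) + ∑ (λ l → f (suc l) + g (suc l))
    ≡⟨ cong (_+_ (f zero + g zero)) (∑-distrib-+ (f ∘ suc) (g ∘ suc)) ⟩
  (f zero + g zero) + (∑ (f ∘ suc) + ∑ (g ∘ suc))
    ≡⟨ interchange (f zero) (g zero) _ _ ⟩
  (f zero + ∑ (f ∘ suc)) + (g zero + ∑ (g ∘ suc)) ∎
  where
  open ≡-Reasoning
  interchange : ∀ a b c d → (a + b) + (c + d) ≡ (a + c) + (b + d)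
  interchange = solve-∀

∑-zero : ∀ {n} (f : Fin n → ℤ) → (∀ l → f l ≡ 0ℤ) → ∑ f ≡ 0ℤ
∑-zero {zero}  f f≡0 = refl
∑-zero {suc n} f f≡0 = cong₂ _+_ (f≡0 zero) (∑-zero (f ∘ suc) (f≡0 ∘ suc))

∑-single : ∀ {n} (f : Fin n → ℤ) c → (∀ l → l ≢ c → f l ≡ 0ℤ) → ∑ f ≡ f c
∑-single {suc n} f zero    f≡0 = begin
  f zero + ∑ (f ∘ suc) ≡⟨ cong (_+_ (f zero)) (∑-zero (f ∘ suc) (λ l → f≡0 (suc l) λ ())) ⟩
  f zero + 0ℤ          ≡⟨ ℤₚ.+-identityʳ (f zero) ⟩
  f zero               ∎
  where open ≡-Reasoning
∑-single {suc n} f (suc c) f≡0 = begin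
  f zero + ∑ (f ∘ suc) ≡⟨ cong₂ _+_ (f≡0 zero λ ()) (∑-single (f ∘ suc) c tail≡0) ⟩
  0ℤ + f (suc c)       ≡⟨ ℤₚ.+-identityˡ (f (suc c)) ⟩
  f (suc c)            ∎
  where
  open ≡-Reasoning
  tail≡0 : ∀ l → l ≢ c → f (suc l) ≡ 0ℤ
  tail≡0 l l≢c = f≡0 (suc l) (l≢c ∘ suc-injective)

∑-*-supportˡ : ∀ {n} {f : Fin n → ℤ} (g : Fin n → ℤ) {c} → (∀ l → l ≢ c → f l ≡ 0ℤ) →
               ∑ (λ l → f l * g l) ≡ f c * g c
∑-*-supportˡ g {c} f≡0 = ∑-single _ c λ l l≢c → cong (_* g l) (f≡0 l l≢c)

∑-*-supportʳ : ∀ {n} {f : Fin n → ℤ} (g : Fin n → ℤ) {c} → (∀ l → l ≢ c → f l ≡ 0ℤ) →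
               ∑ (λ l → g l * f l) ≡ g c * f c
∑-*-supportʳ g {c} f≡0 =
  ∑-single _ c λ l l≢c → trans (cong (g l *_) (f≡0 l l≢c)) (ℤₚ.*-zeroʳ (g l))

∑-cross-supports : ∀ {n} {f g : Fin n → ℤ} (u v : Fin n → ℤ) {c d} →
  (∀ l → l ≢ c → f l ≡ 0ℤ) → (∀ l → l ≢ d → g l ≡ 0ℤ) →
  ∑ (λ l → f l * u l + v l * g l) ≡ 0ℤ → f c * u c + v d * g d ≡ 0ℤ
∑-cross-supports {f = f} {g} u v f≡0 g≡0 ∑≡0 = begin
  _                                         ≡⟨ cong₂ _+_ (∑-*-supportˡ u f≡0) (∑-*-supportʳ v g≡0) ⟨
  ∑ (λ l → f l * u l) + ∑ (λ l → v l * g l) ≡⟨ ∑-distrib-+ (λ l → f l * u l) (λ l → v l * g l) ⟨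
  ∑ (λ l → f l * u l + v l * g l)           ≡⟨ ∑≡0 ⟩
  0ℤ                                        ∎
  where open ≡-Reasoning

∑-bilinear : ∀ {n} (f g h k : Fin n → ℤ) →
  ∑ (λ l → (f l + g l) * (h l + k l)) ≡
  ∑ (λ l → f l * h l) + ∑ (λ l → f l * k l + g l * h l) + ∑ (λ l → g l * k l)
∑-bilinear f g h k = begin
  ∑ (λ l → (f l + g l) * (h l + k l))
    ≡⟨ ∑-cong (λ l → expand (f l) (g l) (h l) (k l)) ⟩
  ∑ (λ l → f l * h l + (f l * k l + g l * h l) + g l * k l)
    ≡⟨ ∑-distrib-+ (λ l → f l * h l + (f l * k l + g l * h l)) (λ l → g l * k l) ⟩
  ∑ (λ l → f l * h l + (f l * k l + g l * h l)) + ∑ (λ l → g l * k l)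
    ≡⟨ cong (_+ ∑ (λ l → g l * k l)) (∑-distrib-+ (λ l → f l * h l) (λ l → f l * k l + g l * h l)) ⟩
  ∑ (λ l → f l * h l) + ∑ (λ l → f l * k l + g l * h l) + ∑ (λ l → g l * k l) ∎
  where
  open ≡-Reasoning
  expand : ∀ a b c d → (a + b) * (c + d) ≡ a * c + (a * d + b * c) + b * d
  expand = solve-∀

∑ℕ : ∀ {n} → (Fin n → ℕ) → ℕ
∑ℕ {zero}  g = 0
∑ℕ {suc n} g = g zero ℕ.+ ∑ℕ (g ∘ suc)

∑-pos : ∀ {n} (g : Fin n → ℕ) → ∑ (λ l → + g l) ≡ + ∑ℕ g
∑-pos {zero}  g = refl
∑-pos {suc n} g = trans (cong (_+_ (+ g zero)) (∑-pos (g ∘ suc))) (sym (ℤₚ.pos-+ (g zero) _))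

∑ℕ-∣ : ∀ {n d} (g : Fin n → ℕ) → (∀ l → d ∣ g l) → d ∣ ∑ℕ g
∑ℕ-∣ {zero}  g d∣g = divides 0 refl
∑ℕ-∣ {suc n} g d∣g = ∣m∣n⇒∣m+n (d∣g zero) (∑ℕ-∣ (g ∘ suc) (d∣g ∘ suc))

∑ℕ-zero : ∀ {n} (g : Fin n → ℕ) → ∑ℕ g ≡ 0 → ∀ l → g l ≡ 0
∑ℕ-zero {suc n} g ∑≡0 zero    = ℕₚ.m+n≡0⇒m≡0 (g zero) ∑≡0
∑ℕ-zero {suc n} g ∑≡0 (suc l) = ∑ℕ-zero (g ∘ suc) (ℕₚ.m+n≡0⇒n≡0 (g zero) ∑≡0) l

∑ℕ-bits≤ : ∀ {n} (g : Fin n → ℕ) → (∀ l → g l ≤ 1) → ∑ℕ g ≤ n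
∑ℕ-bits≤ {zero}  g bits = z≤n
∑ℕ-bits≤ {suc n} g bits = ℕₚ.+-mono-≤ (bits zero) (∑ℕ-bits≤ (g ∘ suc) (bits ∘ suc))

bit-split : ∀ {b s n} → b ≤ 1 → s ≤ n → b ℕ.+ s ≡ suc n → b ≡ 1 × s ≡ n
bit-split z≤n       s≤n refl = ⊥-elim (ℕₚ.1+n≰n s≤n)
bit-split (s≤s z≤n) s≤n refl = refl , refl

∑ℕ-bits≡length : ∀ {n} (g : Fin n → ℕ) → (∀ l → g l ≤ 1) → ∑ℕ g ≡ n → ∀ l → g l ≡ 1
∑ℕ-bits≡length {suc n} g bits ∑≡n l
  with g₀≡1 , rest≡n ← bit-split (bits zero) (∑ℕ-bits≤ (g ∘ suc) (bits ∘ suc)) ∑≡n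
  with l
... | zero  = g₀≡1
... | suc l = ∑ℕ-bits≡length (g ∘ suc) (bits ∘ suc) rest≡n l

bit : ∀ {b} → b ≤ 1 → b ≡ 0 ⊎ b ≡ 1
bit z≤n       = inj₁ refl
bit (s≤s z≤n) = inj₂ refl

∑ℕ-bits≡1 : ∀ {n} (g : Fin n → ℕ) → (∀ l → g l ≤ 1) → ∑ℕ g ≡ 1 →
            ∃ λ c → g c ≢ 0 × (∀ l → l ≢ c → g l ≡ 0)
∑ℕ-bits≡1 {suc n} g bits ∑≡1 with bit (bits zero)
... | inj₁ g₀≡0 =
  let c , gc≢0 , elsewhere = ∑ℕ-bits≡1 (g ∘ suc) (bits ∘ suc) rest≡1
  in  suc c , gc≢0 , λ { zero _ → g₀≡0 ; (suc l) l≢c → elsewhere l (l≢c ∘ cong suc) }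
  where
  rest≡1 : ∑ℕ (g ∘ suc) ≡ 1
  rest≡1 = trans (cong (ℕ._+ ∑ℕ (g ∘ suc)) (sym g₀≡0)) ∑≡1
... | inj₂ g₀≡1 = zero , (λ g₀≡0 → 1≢0 (trans (sym g₀≡1) g₀≡0)) , λ
  { zero    0≢0 → ⊥-elim (0≢0 refl)
  ; (suc l) _   → ∑ℕ-zero (g ∘ suc) rest≡0 l }
  where
  1≢0 : 1 ≢ 0
  1≢0 ()
  rest≡0 : ∑ℕ (g ∘ suc) ≡ 0
  rest≡0 = ℕₚ.suc-injective (trans (cong (ℕ._+ ∑ℕ (g ∘ suc)) (sym g₀≡1)) ∑≡1)

data IsSign : ℤ → Set where
  sign⁺ : IsSign 1ℤ
  sign⁻ : IsSign -1ℤ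

data IsTrit : ℤ → Set where
  trit⁰ : IsTrit 0ℤ
  trit± : ∀ {s} → IsSign s → IsTrit s

sign≢0 : ∀ {s} → IsSign s → s ≢ 0ℤ
sign≢0 sign⁺ ()
sign≢0 sign⁻ ()

sign≢neg : ∀ {s} → IsSign s → s ≢ - s
sign≢neg sign⁺ ()
sign≢neg sign⁻ ()

sign-neg : ∀ {s} → IsSign s → IsSign (- s)
sign-neg sign⁺ = sign⁻
sign-neg sign⁻ = sign⁺

sign-* : ∀ {s t} → IsSign s → IsSign t → IsSign (s * t)
sign-* sign⁺ sign⁺ = sign⁺
sign-* sign⁺ sign⁻ = sign⁻
sign-* sign⁻ sign⁺ = sign⁻
sign-* sign⁻ sign⁻ = sign⁺

sign-sq : ∀ {s} → IsSign s → s * s ≡ 1ℤ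
sign-sq sign⁺ = refl
sign-sq sign⁻ = refl

trit-neg : ∀ {t} → IsTrit t → IsTrit (- t)
trit-neg trit⁰     = trit⁰
trit-neg (trit± s) = trit± (sign-neg s)

trit≢0⇒sign : ∀ {t} → IsTrit t → t ≢ 0ℤ → IsSign t
trit≢0⇒sign trit⁰     t≢0 = ⊥-elim (t≢0 refl)
trit≢0⇒sign (trit± s) _   = s

trit-sq : ∀ {t} → IsTrit t → t * t ≡ + ∣ t ∣
trit-sq trit⁰         = refl
trit-sq (trit± sign⁺) = refl
trit-sq (trit± sign⁻) = refl

trit-∣∣≤1 : ∀ {t} → IsTrit t → ∣ t ∣ ≤ 1
trit-∣∣≤1 trit⁰         = z≤n
trit-∣∣≤1 (trit± sign⁺) = s≤s z≤n
trit-∣∣≤1 (trit± sign⁻) = s≤s z≤n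

∑-sq-trits : ∀ {n} (f : Fin n → ℤ) → (∀ l → IsTrit (f l)) →
             ∑ (λ l → f l * f l) ≡ + ∑ℕ (λ l → ∣ f l ∣)
∑-sq-trits f trits = trans (∑-cong (λ l → trit-sq (trits l))) (∑-pos (λ l → ∣ f l ∣))

sign-cancel-sq : ∀ {s} → IsSign s → ∀ x → s * s * x ≡ x
sign-cancel-sq s x = trans (cong (_* x) (sign-sq s)) (ℤₚ.*-identityˡ x)

sign-solve : ∀ {a x b} → IsSign a → a * x + b ≡ 0ℤ → x ≡ - (a * b)
sign-solve {a} {x} {b} sa ax+b≡0 = begin
  x           ≡⟨ sign-cancel-sq sa x ⟨
  a * a * x   ≡⟨ ℤₚ.*-assoc a a x ⟩
  a * (a * x) ≡⟨ cong (a *_) (inverseˡ-unique (a * x) b ax+b≡0) ⟩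
  a * - b     ≡⟨ ℤₚ.neg-distribʳ-* a b ⟨
  - (a * b)   ∎
  where open ≡-Reasoning

sign-flip : ∀ {α γ δ s X Y} → IsSign α → IsSign γ → IsSign δ →
            α * X + γ * δ ≡ 0ℤ → γ * Y ≡ s * X → Y * δ ≡ - (s * α)
sign-flip {α} {γ} {δ} {s} {X} {Y} sα sγ sδ e₁ e₂ = begin
  Y * δ                             ≡⟨ sign-cancel-sq sγ (Y * δ) ⟨
  γ * γ * (Y * δ)                   ≡⟨ regroup γ Y δ ⟩
  γ * (γ * Y) * δ                   ≡⟨ cong (λ u → γ * u * δ) e₂ ⟩
  γ * (s * X) * δ                   ≡⟨ cong (λ u → γ * (s * u) * δ) (sign-solve sα e₁) ⟩
  γ * (s * - (α * (γ * δ))) * δ     ≡⟨ collect γ δ s α ⟩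
  - (γ * γ * (δ * δ * (s * α)))     ≡⟨ cong -_ (trans (sign-cancel-sq sγ _) (sign-cancel-sq sδ _)) ⟩
  - (s * α)                         ∎
  where
  open ≡-Reasoning
  regroup : ∀ a b c → a * a * (b * c) ≡ a * (a * b) * c
  regroup = solve-∀
  collect : ∀ a b c d → a * (c * - (d * (a * b))) * b ≡ - (a * a * (b * b * (c * d)))
  collect = solve-∀

sign-match : ∀ {s t a b w u} → IsSign s → IsSign t → IsSign a → IsSign w →
             s * u + w * t ≡ 0ℤ → a * u + w * b ≡ 0ℤ → s * a ≡ t * b
sign-match {s} {t} {a} {b} {w} {u} ss st sa sw e₁ e₂ = begin
  s * a                             ≡⟨ trans (sign-cancel-sq sw _) (sign-cancel-sq st _) ⟨
  w * w * (t * t * (s * a))         ≡⟨ regroup₁ s t a w ⟩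
  a * w * t * (s * (w * t))         ≡⟨ cong (a * w * t *_) same-u ⟩
  a * w * t * (a * (w * b))         ≡⟨ regroup₂ t a b w ⟩
  a * a * (w * w * (t * b))         ≡⟨ trans (sign-cancel-sq sa _) (sign-cancel-sq sw _) ⟩
  t * b                             ∎
  where
  open ≡-Reasoning
  same-u : s * (w * t) ≡ a * (w * b)
  same-u = ℤₚ.neg-injective (trans (sym (sign-solve ss e₁)) (sign-solve sa e₂))
  regroup₁ : ∀ s t a w → w * w * (t * t * (s * a)) ≡ a * w * t * (s * (w * t))
  regroup₁ = solve-∀
  regroup₂ : ∀ t a b w → a * w * t * (a * (w * b)) ≡ a * a * (w * w * (t * b))
  regroup₂ = solve-∀

ones : ∀ {k} → Fin k → ℤ
ones _ = 1ℤ

zeros : ∀ {k} → Fin k → ℤ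
zeros _ = 0ℤ

basis : ∀ {k} → Fin k → Fin k → ℤ
basis a b = δ a b 1ℤ

ones-trit : ∀ {k} (a : Fin k) → IsTrit (ones a)
ones-trit _ = trit± sign⁺

basis-trit : ∀ {k} (a b : Fin k) → IsTrit (basis a b)
basis-trit zero    zero    = trit± sign⁺
basis-trit zero    (suc b) = trit⁰
basis-trit (suc a) zero    = trit⁰
basis-trit (suc a) (suc b) = basis-trit a b

δ-diag : ∀ {n} (i : Fin n) v → δ i i v ≡ v
δ-diag zero    v = refl
δ-diag (suc i) v = δ-diag i v

δ-off : ∀ {n} {i j : Fin n} v → i ≢ j → δ i j v ≡ 0ℤ
δ-off {i = zero}  {zero}  v i≢j = ⊥-elim (i≢j refl)
δ-off {i = zero}  {suc j} v i≢j = refl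
δ-off {i = suc i} {zero}  v i≢j = refl
δ-off {i = suc i} {suc j} v i≢j = δ-off v (i≢j ∘ cong suc)

δ≢0⇒≡ : ∀ {n} (i j : Fin n) {v} → δ i j v ≢ 0ℤ → i ≡ j
δ≢0⇒≡ zero    zero    δ≢0 = refl
δ≢0⇒≡ zero    (suc j) δ≢0 = ⊥-elim (δ≢0 refl)
δ≢0⇒≡ (suc i) zero    δ≢0 = ⊥-elim (δ≢0 refl)
δ≢0⇒≡ (suc i) (suc j) δ≢0 = cong suc (δ≢0⇒≡ i j δ≢0)

⟦⟧-cong : ∀ {k} (e : Entry k) {x y : Fin k → ℤ} → (∀ a → x a ≡ y a) → ⟦ e ⟧ x ≡ ⟦ e ⟧ y
⟦⟧-cong zer     x≗y = refl
⟦⟧-cong (pos a) x≗y = x≗y a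
⟦⟧-cong (neg a) x≗y = cong -_ (x≗y a)

⟦⟧-+ : ∀ {k} (e : Entry k) (x y : Fin k → ℤ) → ⟦ e ⟧ (λ a → x a + y a) ≡ ⟦ e ⟧ x + ⟦ e ⟧ y
⟦⟧-+ zer     x y = refl
⟦⟧-+ (pos a) x y = refl
⟦⟧-+ (neg a) x y = ℤₚ.neg-distrib-+ (x a) (y a)

⟦⟧-zeros : ∀ {k} (e : Entry k) → ⟦ e ⟧ zeros ≡ 0ℤ
⟦⟧-zeros zer     = refl
⟦⟧-zeros (pos a) = refl
⟦⟧-zeros (neg a) = refl

⟦⟧-trit : ∀ {k} (e : Entry k) {x : Fin k → ℤ} → (∀ a → IsTrit (x a)) → IsTrit (⟦ e ⟧ x)
⟦⟧-trit zer     trits = trit⁰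
⟦⟧-trit (pos a) trits = trits a
⟦⟧-trit (neg a) trits = trit-neg (trits a)

⟦⟧-basis-injective : ∀ {k} (e : Entry k) {a a'} →
                     ⟦ e ⟧ (basis a) ≢ 0ℤ → ⟦ e ⟧ (basis a') ≢ 0ℤ → a ≡ a'
⟦⟧-basis-injective zer     ≢0 _   = ⊥-elim (≢0 refl)
⟦⟧-basis-injective (pos v) ≢0 ≢0' = trans (δ≢0⇒≡ _ v ≢0) (sym (δ≢0⇒≡ _ v ≢0'))
⟦⟧-basis-injective (neg v) ≢0 ≢0' =
  trans (δ≢0⇒≡ _ v (≢0 ∘ cong -_)) (sym (δ≢0⇒≡ _ v (≢0' ∘ cong -_)))

⟦⟧-ones≢0 : ∀ {k} (e : Entry k) → ⟦ e ⟧ ones ≢ 0ℤ → ∃ λ a → ⟦ e ⟧ (basis a) ≢ 0ℤ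
⟦⟧-ones≢0 zer     ≢0 = ⊥-elim (≢0 refl)
⟦⟧-ones≢0 (pos a) _  = a , sign≢0 sign⁺ ∘ trans (sym (δ-diag a 1ℤ))
⟦⟧-ones≢0 (neg a) _  = a , sign≢0 sign⁻ ∘ trans (sym (cong -_ (δ-diag a 1ℤ)))

sign-sum-product : ∀ {a b c} → IsSign a → IsSign b → IsSign c →
                   ∃ λ k → (a + b) * (a + c) ≡ + (4 ℕ.* k)
sign-sum-product sign⁺ sign⁺ sign⁺ = 1 , refl
sign-sum-product sign⁺ sign⁺ sign⁻ = 0 , refl
sign-sum-product sign⁺ sign⁻ _     = 0 , refl
sign-sum-product sign⁻ sign⁺ _     = 0 , refl
sign-sum-product sign⁻ sign⁻ sign⁺ = 0 , refl
sign-sum-product sign⁻ sign⁻ sign⁻ = 1 , refl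

∑-ones : ∀ {n} → ∑ {n} ones ≡ + n
∑-ones {zero}  = refl
∑-ones {suc n} = cong (_+_ 1ℤ) ∑-ones

orthogonal-signs⇒4∣length : ∀ {n} (f g h : Fin n → ℤ) →
  (∀ l → IsSign (f l)) → (∀ l → IsSign (g l)) → (∀ l → IsSign (h l)) →
  ∑ (λ l → f l * g l) ≡ 0ℤ → ∑ (λ l → f l * h l) ≡ 0ℤ → ∑ (λ l → g l * h l) ≡ 0ℤ →
  4 ∣ n
orthogonal-signs⇒4∣length {n} f g h sf sg sh fg≡0 fh≡0 gh≡0 =
  subst (4 ∣_) (ℤₚ.+-injective (begin
    + ∑ℕ (λ l → 4 ℕ.* k l)              ≡⟨ ∑-pos (λ l → 4 ℕ.* k l) ⟨
    ∑ (λ l → + (4 ℕ.* k l))             ≡⟨ ∑-cong (λ l → proj₂ (sign-sum-product (sf l) (sg l) (sh l))) ⟨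
    ∑ (λ l → (f l + g l) * (f l + h l)) ≡⟨ ∑-bilinear f g f h ⟩
    ∑ (λ l → f l * f l) + ∑ (λ l → f l * h l + g l * f l) + ∑ (λ l → g l * h l)
                                        ≡⟨ cong₂ _+_ (cong₂ _+_ ff≡n cross≡0) gh≡0 ⟩
    + n + 0ℤ + 0ℤ                       ≡⟨ trans (ℤₚ.+-identityʳ _) (ℤₚ.+-identityʳ (+ n)) ⟩
    + n                                 ∎))
    (∑ℕ-∣ (λ l → 4 ℕ.* k l) (λ l → m∣m*n (k l)))
  where
  open ≡-Reasoning
  k : Fin n → ℕ
  k l = proj₁ (sign-sum-product (sf l) (sg l) (sh l))
  ff≡n : ∑ (λ l → f l * f l) ≡ + n
  ff≡n = trans (∑-cong (sign-sq ∘ sf)) ∑-ones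
  cross≡0 : ∑ (λ l → f l * h l + g l * f l) ≡ 0ℤ
  cross≡0 = trans (∑-distrib-+ (λ l → f l * h l) (λ l → g l * f l))
                  (cong₂ _+_ fh≡0 (trans (∑-cong (λ l → ℤₚ.*-comm (g l) (f l))) fg≡0))

module ODProperties {n k} {C : Mat n k} {c : Vec ℕ k} (od : IsOD C c) where

  od-orthogonal : ∀ x {i j} → i ≢ j → ∑ (λ l → ⟦ C i l ⟧ x * ⟦ C j l ⟧ x) ≡ 0ℤ
  od-orthogonal x i≢j = trans (od x _ _) (δ-off _ i≢j)

  od-polarised : ∀ x y {i j} → i ≢ j →
    ∑ (λ l → ⟦ C i l ⟧ x * ⟦ C j l ⟧ y + ⟦ C i l ⟧ y * ⟦ C j l ⟧ x) ≡ 0ℤ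
  od-polarised x y {i} {j} i≢j = begin
    cross                                         ≡⟨ pad ⟨
    ∑ (row i x · row j x) + cross + ∑ (row i y · row j y)
      ≡⟨ ∑-bilinear (row i x) (row i y) (row j x) (row j y) ⟨
    ∑ (λ l → (row i x l + row i y l) * (row j x l + row j y l))
      ≡⟨ ∑-cong (λ l → cong₂ _*_ (⟦⟧-+ (C i l) x y) (⟦⟧-+ (C j l) x y)) ⟨
    ∑ (row i x+y · row j x+y)                     ≡⟨ od-orthogonal x+y i≢j ⟩
    0ℤ                                            ∎
    where
    open ≡-Reasoning
    row : Fin n → (Fin k → ℤ) → Fin n → ℤ
    row i x l = ⟦ C i l ⟧ x
    _·_ : (Fin n → ℤ) → (Fin n → ℤ) → Fin n → ℤ
    (f · g) l = f l * g l
    x+y : Fin k → ℤ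
    x+y a = x a + y a
    cross = ∑ (λ l → row i x l * row j y l + row i y l * row j x l)
    pad : ∑ (row i x · row j x) + cross + ∑ (row i y · row j y) ≡ cross
    pad = begin
      ∑ (row i x · row j x) + cross + ∑ (row i y · row j y)
        ≡⟨ cong₂ (λ p q → p + cross + q) (od-orthogonal x i≢j) (od-orthogonal y i≢j) ⟩
      0ℤ + cross + 0ℤ ≡⟨ ℤₚ.+-identityʳ _ ⟩
      0ℤ + cross      ≡⟨ ℤₚ.+-identityˡ cross ⟩
      cross           ∎

  row-weight : ∀ {x w} → (∀ a → IsTrit (x a)) → quadForm c x ≡ + w →
               ∀ i → ∑ℕ (λ l → ∣ ⟦ C i l ⟧ x ∣) ≡ w
  row-weight {x} trits q i = ℤₚ.+-injective (begin
    + ∑ℕ (λ l → ∣ ⟦ C i l ⟧ x ∣)             ≡⟨ ∑-sq-trits _ (λ l → ⟦⟧-trit (C i l) trits) ⟨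
    ∑ (λ l → ⟦ C i l ⟧ x * ⟦ C i l ⟧ x)      ≡⟨ od x i i ⟩
    δ i i (quadForm c x)                     ≡⟨ δ-diag i _ ⟩
    quadForm c x                             ≡⟨ q ⟩
    + _                                      ∎)
    where open ≡-Reasoning

  weight≤order : ∀ {x w} → (∀ a → IsTrit (x a)) → quadForm c x ≡ + w → Fin n → w ≤ n
  weight≤order {x} trits q i = subst (_≤ n) (row-weight trits q i)
    (∑ℕ-bits≤ _ (λ l → trit-∣∣≤1 (⟦⟧-trit (C i l) trits)))

  full-weight⇒nonzero : ∀ {x} → (∀ a → IsTrit (x a)) → quadForm c x ≡ + n →
                        ∀ i l → ⟦ C i l ⟧ x ≢ 0ℤ
  full-weight⇒nonzero trits q i l ≡0 =
    0≢1 (trans (sym (cong ∣_∣ ≡0))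
               (∑ℕ-bits≡length _ (λ l → trit-∣∣≤1 (⟦⟧-trit (C i l) trits)) (row-weight trits q i) l))
    where
    0≢1 : 0 ≢ 1
    0≢1 ()

  unit-weight⇒single : ∀ {x} → (∀ a → IsTrit (x a)) → quadForm c x ≡ 1ℤ → ∀ i →
    ∃ λ col → ⟦ C i col ⟧ x ≢ 0ℤ × (∀ l → l ≢ col → ⟦ C i l ⟧ x ≡ 0ℤ)
  unit-weight⇒single trits q i
    with col , ≢0 , elsewhere ← ∑ℕ-bits≡1 _ (λ l → trit-∣∣≤1 (⟦⟧-trit (C i l) trits))
                                            (row-weight trits q i)
    = col , ≢0 ∘ cong ∣_∣ , λ l l≢col → ℤₚ.∣i∣≡0⇒i≡0 (elsewhere l l≢col)

  full-weight⇒4∣order : quadForm c ones ≡ + n → 3 ≤ n → 4 ∣ n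
  full-weight⇒4∣order q (s≤s (s≤s (s≤s _))) =
    orthogonal-signs⇒4∣length (row zero) (row (suc zero)) (row (suc (suc zero)))
      (row-sign zero) (row-sign (suc zero)) (row-sign (suc (suc zero)))
      (orthogonal λ ()) (orthogonal λ ()) (orthogonal λ ())
    where
    row : Fin n → Fin n → ℤ
    row i l = ⟦ C i l ⟧ ones
    row-sign : ∀ i l → IsSign (row i l)
    row-sign i l = trit≢0⇒sign (⟦⟧-trit (C i l) ones-trit) (full-weight⇒nonzero ones-trit q i l)
    orthogonal : ∀ {i j} → i ≢ j → ∑ (λ l → row i l * row j l) ≡ 0ℤ
    orthogonal = od-orthogonal ones

quadForm-basis : ∀ a → quadForm (1 ∷ 1 ∷ 1 ∷ []) (basis a) ≡ 1ℤ
quadForm-basis zero             = refl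
quadForm-basis (suc zero)       = refl
quadForm-basis (suc (suc zero)) = refl

module SignedPermutation {n} {M : Mat n 3} (od : IsOD M (1 ∷ 1 ∷ 1 ∷ [])) where
  open ODProperties {C = M} {c = 1 ∷ 1 ∷ 1 ∷ []} od

  entry : Fin 3 → Fin n → Fin n → ℤ
  entry a i l = ⟦ M i l ⟧ (basis a)

  private
    single : ∀ a i → ∃ λ c → entry a i c ≢ 0ℤ × (∀ l → l ≢ c → entry a i l ≡ 0ℤ)
    single a = unit-weight⇒single (basis-trit a) (quadForm-basis a)

  col : Fin 3 → Fin n → Fin n
  col a i = proj₁ (single a i)

  entry-col≢0 : ∀ a i → entry a i (col a i) ≢ 0ℤ
  entry-col≢0 a i = proj₁ (proj₂ (single a i))

  col-unique : ∀ a {i l} → entry a i l ≢ 0ℤ → l ≡ col a i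
  col-unique a {i} {l} l≢0 with l ≟ col a i
  ... | yes l≡col = l≡col
  ... | no  l≢col = ⊥-elim (l≢0 (proj₂ (proj₂ (single a i)) l l≢col))

  entry-elsewhere : ∀ a {i c} → entry a i c ≢ 0ℤ → ∀ l → l ≢ c → entry a i l ≡ 0ℤ
  entry-elsewhere a {i} c≢0 l l≢c =
    proj₂ (proj₂ (single a i)) l (λ l≡col → l≢c (trans l≡col (sym (col-unique a c≢0))))

  entry-sign : ∀ a {i c} → entry a i c ≢ 0ℤ → IsSign (entry a i c)
  entry-sign a {i} {c} = trit≢0⇒sign (⟦⟧-trit (M i c) (basis-trit a))

  col-sign : ∀ a i → IsSign (entry a i (col a i))
  col-sign a i = entry-sign a (entry-col≢0 a i)

  polarised : ∀ a a' {i j} → i ≢ j →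
    ∑ (λ l → entry a i l * entry a' j l + entry a' i l * entry a j l) ≡ 0ℤ
  polarised a a' = od-polarised (basis a) (basis a')

  col-injective : ∀ a → Injective _≡_ _≡_ (col a)
  col-injective a {i} {j} same with i ≟ j
  ... | yes i≡j = i≡j
  ... | no  i≢j = ⊥-elim (sign≢0 (sign-* (entry-sign a i-col≢0) (entry-sign a j-col≢0)) (begin
    entry a i (col a i) * entry a j (col a i) ≡⟨ ∑-*-supportˡ (entry a j) (entry-elsewhere a i-col≢0) ⟨
    ∑ (λ l → entry a i l * entry a j l)       ≡⟨ od-orthogonal (basis a) i≢j ⟩
    0ℤ                                        ∎))
    where
    open ≡-Reasoning
    i-col≢0 : entry a i (col a i) ≢ 0ℤ
    i-col≢0 = entry-col≢0 a i
    j-col≢0 : entry a j (col a i) ≢ 0ℤ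
    j-col≢0 = subst (λ c → entry a j c ≢ 0ℤ) (sym same) (entry-col≢0 a j)

  col-distinct : ∀ {a a'} i → col a i ≡ col a' i → a ≡ a'
  col-distinct {a} {a'} i same = ⟦⟧-basis-injective (M i (col a i)) (entry-col≢0 a i)
    (subst (λ c → entry a' i c ≢ 0ℤ) (sym same) (entry-col≢0 a' i))

module OrthogonalSum {n r t} {M : Mat n r} {N : Mat n t} {c} (od : IsODPoly (M ⊕ N) c) where

  H : Mat n (r ℕ.+ t)
  H = proj₁ od

  H-od : IsOD H c
  H-od = proj₂ (proj₂ od)

  open ODProperties {C = H} {c = c} H-od

  H-entry : ∀ i l x y → ⟦ H i l ⟧ (x ⧺ y) ≡ ⟦ M i l ⟧ x + ⟦ N i l ⟧ y
  H-entry i l x y = trans (proj₁ (proj₂ od) i l (x ⧺ y))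
    (cong₂ _+_ (⟦⟧-cong (M i l) (lookup-++ˡ x y)) (⟦⟧-cong (N i l) (lookup-++ʳ x y)))

  polarised : ∀ x y {i j} → i ≢ j →
    ∑ (λ l → ⟦ M i l ⟧ x * ⟦ N j l ⟧ y + ⟦ N i l ⟧ y * ⟦ M j l ⟧ x) ≡ 0ℤ
  polarised x y {i} {j} i≢j = trans
    (∑-cong λ l → cong₂ _+_ (cong₂ _*_ (only-M i l) (only-N j l)) (cong₂ _*_ (only-N i l) (only-M j l)))
    (od-polarised (x ⧺ zeros) (zeros ⧺ y) i≢j)
    where
    only-M : ∀ i l → ⟦ M i l ⟧ x ≡ ⟦ H i l ⟧ (x ⧺ zeros)
    only-M i l = sym (trans (H-entry i l x zeros)
      (trans (cong (_+_ (⟦ M i l ⟧ x)) (⟦⟧-zeros (N i l))) (ℤₚ.+-identityʳ _)))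
    only-N : ∀ i l → ⟦ N i l ⟧ y ≡ ⟦ H i l ⟧ (zeros ⧺ y)
    only-N i l = sym (trans (H-entry i l zeros y)
      (trans (cong (_+ ⟦ N i l ⟧ y) (⟦⟧-zeros (M i l))) (ℤₚ.+-identityˡ _)))

  nonzero-at-ones : quadForm c ones ≡ + n → ∀ i l → ⟦ M i l ⟧ ones + ⟦ N i l ⟧ ones ≢ 0ℤ
  nonzero-at-ones q i l =
    full-weight⇒nonzero ones-trit q i l ∘ trans (proj₁ (proj₂ od) i l ones)

injective⇒surjective : ∀ {n} {f : Fin n → Fin n} → Injective _≡_ _≡_ f → ∀ c → ∃ λ m → f m ≡ c
injective⇒surjective {suc n} {f} f-inj c with any? (λ m → f m ≟ c)
... | yes hit  = hit
... | no  miss = ⊥-elim (ℕₚ.1+n≰n (injective⇒≤ squeeze-injective))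
  where
  c≢f : ∀ m → c ≢ f m
  c≢f m c≡fm = miss (m , sym c≡fm)
  squeeze : Fin (suc n) → Fin n
  squeeze m = punchOut (c≢f m)
  squeeze-injective : Injective _≡_ _≡_ squeeze
  squeeze-injective = f-inj ∘ punchOut-injective (c≢f _) (c≢f _)

module _ {n k b} (colour : Fin n → Fin k) (block : Fin n → Fin b → Fin n)
         (class⊆block : ∀ i m → colour i ≡ colour m → ∃ λ t → block i t ≡ m) where

  private
    Class : Fin k → Set
    Class c = ∃ λ i → colour i ≡ c

    search : ∀ c → Dec (Class c)
    search c = any? (λ i → colour i ≟ c)

    slot : ∀ {c} → Dec (Class c) → ∀ m → colour m ≡ c → Fin b
    slot (yes (i , ci≡c)) m cm≡c = proj₁ (class⊆block i m (trans ci≡c (sym cm≡c)))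
    slot (no  ∄)          m cm≡c = ⊥-elim (∄ (m , cm≡c))

    slot-injective : ∀ {c} (found : Dec (Class c)) {m m'} (cm : colour m ≡ c) (cm' : colour m' ≡ c) →
                     slot found m cm ≡ slot found m' cm' → m ≡ m'
    slot-injective (yes (i , ci)) cm cm' same = begin
      _                                        ≡⟨ proj₂ (class⊆block i _ (trans ci (sym cm))) ⟨
      block i (slot (yes (i , ci)) _ cm)       ≡⟨ cong (block i) same ⟩
      block i (slot (yes (i , ci)) _ cm')      ≡⟨ proj₂ (class⊆block i _ (trans ci (sym cm'))) ⟩
      _                                        ∎
      where open ≡-Reasoning
    slot-injective (no ∄) cm _ _ = ⊥-elim (∄ (_ , cm))

    -- m ↦ (its colour, its position in the block of the first row of that colour).
    label : Fin n → Fin (k ℕ.* b)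
    label m = combine (colour m) (slot (search (colour m)) m refl)

    label-injective : Injective _≡_ _≡_ label
    label-injective {m} {m'} same with combine-injective (colour m) _ (colour m') _ same
    ... | same-colour , same-slot = go refl refl same-colour same-slot
      where
      go : ∀ {c c'} (cm : colour m ≡ c) (cm' : colour m' ≡ c') → c ≡ c' →
           slot (search c) m cm ≡ slot (search c') m' cm' → m ≡ m'
      go cm cm' refl = slot-injective (search _) cm cm'

  classes-in-blocks⇒order≤ : n ≤ k ℕ.* b
  classes-in-blocks⇒order≤ = injective⇒≤ label-injective

quadForm-full : ∀ {n} → 3 ≤ n → quadForm (1 ∷ 1 ∷ 1 ∷ (n ∸ 3) ∷ []) ones ≡ + n
quadForm-full {n} 3≤n = trans
  (cong (λ z → 1ℤ + (1ℤ + (1ℤ + z))) (trans (ℤₚ.+-identityʳ _) (ℤₚ.*-identityʳ (+ (n ∸ 3)))))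
  (cong +_ (ℕₚ.m+[n∸m]≡n 3≤n))

module ProductDesign {n} (pd : PD n (1 ∷ 1 ∷ 1 ∷ []) (1 ∷ 1 ∷ 1 ∷ []) ((n ∸ 3) ∷ []))
                     (3≤n : 3 ≤ n) where
  open PD pd
  private
    module A = SignedPermutation {M = M₁} M₁-OD
    module B = SignedPermutation {M = M₂} M₂-OD
    module H₁ = OrthogonalSum {M = M₁} {N = N} {c = 1 ∷ 1 ∷ 1 ∷ (n ∸ 3) ∷ []} sum₁-OD
    module H₂ = OrthogonalSum {M = M₂} {N = N} {c = 1 ∷ 1 ∷ 1 ∷ (n ∸ 3) ∷ []} sum₂-OD

  v₁ v₂ v₃ : Fin 3
  v₁ = zero
  v₂ = suc zero
  v₃ = suc (suc zero)

  π : Fin n → Fin n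
  π = A.col v₁

  π⁻¹ : Fin n → Fin n
  π⁻¹ c = proj₁ (injective⇒surjective (A.col-injective v₁) c)

  π-π⁻¹ : ∀ c → π (π⁻¹ c) ≡ c
  π-π⁻¹ c = proj₂ (injective⇒surjective (A.col-injective v₁) c)

  π⁻¹-π : ∀ m → π⁻¹ (π m) ≡ m
  π⁻¹-π m = A.col-injective v₁ (π-π⁻¹ (π m))

  pivot : Fin n → ℤ
  pivot m = A.entry v₁ m (π m)

  pivot-sign : ∀ m → IsSign (pivot m)
  pivot-sign = A.col-sign v₁

  partnerOf : Fin 3 → Fin n → Fin n
  partnerOf a m = π⁻¹ (A.col a m)

  partner : Fin n → Fin n
  partner = partnerOf v₂

  π-partnerOf : ∀ a m → π (partnerOf a m) ≡ A.col a m
  π-partnerOf a m = π-π⁻¹ (A.col a m)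

  partner-irreflexive : ∀ m → m ≢ partner m
  partner-irreflexive m m≡pm = v₁≢v₂ (A.col-distinct m (trans (cong π m≡pm) (π-partnerOf v₂ m)))
    where
    v₁≢v₂ : v₁ ≢ v₂
    v₁≢v₂ ()

  x₂-sign : ∀ m → IsSign (A.entry v₂ m (π (partner m)))
  x₂-sign m = subst (λ c → IsSign (A.entry v₂ m c)) (sym (π-partnerOf v₂ m)) (A.col-sign v₂ m)

  partner-relation : ∀ m →
    pivot m * A.entry v₂ (partner m) (π m) + A.entry v₂ m (π (partner m)) * pivot (partner m) ≡ 0ℤ
  partner-relation m = ∑-cross-supports (A.entry v₂ (partner m)) (A.entry v₂ m)
    (A.entry-elsewhere v₁ (A.entry-col≢0 v₁ m)) (A.entry-elsewhere v₁ (A.entry-col≢0 v₁ (partner m)))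
    (A.polarised v₁ v₂ (partner-irreflexive m))

  partner-involutive : ∀ m → partner (partner m) ≡ m
  partner-involutive m = begin
    π⁻¹ (A.col v₂ (partner m)) ≡⟨ cong π⁻¹ (A.col-unique v₂ (sign≢0 X-sign)) ⟨
    π⁻¹ (π m)                  ≡⟨ π⁻¹-π m ⟩
    m                          ∎
    where
    open ≡-Reasoning
    X-sign : IsSign (A.entry v₂ (partner m) (π m))
    X-sign = subst IsSign (sym (sign-solve (pivot-sign m) (partner-relation m)))
      (sign-neg (sign-* (pivot-sign m) (sign-* (x₂-sign m) (pivot-sign (partner m)))))

  partner-swap : ∀ {m j} → partner m ≡ j → m ≡ partner j
  partner-swap {m} pm≡j = trans (sym (partner-involutive m)) (cong partner pm≡j)

  W : Fin n → Fin n → ℤ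
  W i l = ⟦ N i l ⟧ ones

  W-at-pivot : ∀ m → W m (π m) ≡ 0ℤ
  W-at-pivot m with ℤₚ.i*j≡0⇒i≡0∨j≡0 _ (hadamard₁ m (π m) (basis v₁) ones)
  ... | inj₁ pivot≡0 = ⊥-elim (sign≢0 (pivot-sign m) pivot≡0)
  ... | inj₂ W≡0     = W≡0

  W-off-block : ∀ i m → m ≢ i → m ≢ partner i → m ≢ partnerOf v₃ i → W i (π m) ≢ 0ℤ
  W-off-block i m m≢i m≢p₂ m≢p₃ W≡0
    with ⟦⟧-ones≢0 (M₁ i (π m))
           (λ M≡0 → H₁.nonzero-at-ones (quadForm-full 3≤n) i (π m) (cong₂ _+_ M≡0 W≡0))
  ... | a , entry≢0 = excluded a (trans (sym (π⁻¹-π m)) (cong π⁻¹ (A.col-unique a entry≢0)))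
    where
    excluded : ∀ a → m ≢ partnerOf a i
    excluded zero m≡        = m≢i (trans m≡ (π⁻¹-π i))
    excluded (suc zero)       = m≢p₂
    excluded (suc (suc zero)) = m≢p₃

  occupant : ∀ m → ∃ λ b → B.entry b m (π m) ≢ 0ℤ
  occupant m = ⟦⟧-ones≢0 (M₂ m (π m))
    (λ M≡0 → H₂.nonzero-at-ones (quadForm-full 3≤n) m (π m) (cong₂ _+_ M≡0 (W-at-pivot m)))

  colour : Fin n → Fin 3
  colour m = proj₁ (occupant m)

  -- A record rather than a definition, so that b and m can be inferred from a proof.
  record _occupies_ (b : Fin 3) (m : Fin n) : Set where
    constructor occupying
    field occupied : B.entry b m (π m) ≢ 0ℤ
  open _occupies_

  relativeSign : Fin 3 → Fin n → ℤ
  relativeSign b m = B.entry b m (π m) * pivot m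

  relativeSign-sign : ∀ {b m} → b occupies m → IsSign (relativeSign b m)
  relativeSign-sign {b} {m} occ = sign-* (B.entry-sign b (occupied occ)) (pivot-sign m)

  relativeSign-partner : ∀ {b m} → b occupies m → relativeSign b (partner m) ≡ - relativeSign b m
  relativeSign-partner {b} {m} occ =
    sign-flip {s = B.entry b m (π m)} (pivot-sign m) (x₂-sign m) (pivot-sign (partner m))
      (partner-relation m) amicable-at
    where
    open ≡-Reasoning
    amicable-at : A.entry v₂ m (π (partner m)) * B.entry b (partner m) (π (partner m))
                ≡ B.entry b m (π m) * A.entry v₂ (partner m) (π m)
    amicable-at = begin
      _ ≡⟨ ∑-*-supportˡ (B.entry b (partner m)) (A.entry-elsewhere v₂ (sign≢0 (x₂-sign m))) ⟨
      ∑ (λ l → A.entry v₂ m l * B.entry b (partner m) l) ≡⟨ amicable (basis v₂) (basis b) m (partner m) ⟩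
      ∑ (λ l → B.entry b m l * A.entry v₂ (partner m) l)
        ≡⟨ ∑-*-supportˡ (A.entry v₂ (partner m)) (B.entry-elsewhere b (occupied occ)) ⟩
      _ ∎

  occupies-partner : ∀ {b m} → b occupies m → b occupies partner m
  occupies-partner {b} {m} occ = occupying λ B≡0 → sign≢0
    (subst IsSign (sym (relativeSign-partner occ)) (sign-neg (relativeSign-sign occ)))
    (cong (_* pivot (partner m)) B≡0)

  relativeSign-agree : ∀ {b i m} → i ≢ m → b occupies i → b occupies m → W i (π m) ≢ 0ℤ →
                       relativeSign b i ≡ relativeSign b m
  relativeSign-agree {b} {i} {m} i≢m (occupying yᵢ≢0) (occupying yₘ≢0) W≢0 =
    sign-match (B.entry-sign b yᵢ≢0) (B.entry-sign b yₘ≢0) (pivot-sign i)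
      (trit≢0⇒sign (⟦⟧-trit (N i (π m)) ones-trit) W≢0)
      (∑-cross-supports (W m) (W i) (B.entry-elsewhere b yᵢ≢0) (B.entry-elsewhere b yₘ≢0)
        (H₂.polarised (basis b) ones i≢m))
      (∑-cross-supports (W m) (W i) (A.entry-elsewhere v₁ (A.entry-col≢0 v₁ i))
                                    (A.entry-elsewhere v₁ (A.entry-col≢0 v₁ m))
        (H₁.polarised (basis v₁) ones i≢m))

  block : Fin n → Fin 4 → Fin n
  block i = lookup (i ∷ partner i ∷ partnerOf v₃ i ∷ partner (partnerOf v₃ i) ∷ [])

  same-colour⇒in-block : ∀ i m → colour i ≡ colour m → ∃ λ t → block i t ≡ m
  same-colour⇒in-block i m same with any? (λ t → block i t ≟ m)
  ... | yes found = found
  ... | no  ∉     = ⊥-elim (sign≢neg (relativeSign-sign occₘ) (begin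
    relativeSign b m           ≡⟨ relativeSign-agree (≢-sym m≢i) occᵢ occₘ W≢0 ⟨
    relativeSign b i           ≡⟨ relativeSign-agree (≢-sym pm≢i) occᵢ (occupies-partner occₘ) W'≢0 ⟩
    relativeSign b (partner m) ≡⟨ relativeSign-partner occₘ ⟩
    - relativeSign b m         ∎))
    where
    open ≡-Reasoning
    b = colour i
    occᵢ : b occupies i
    occᵢ = occupying (proj₂ (occupant i))
    occₘ : b occupies m
    occₘ = subst (_occupies m) (sym same) (occupying (proj₂ (occupant m)))
    outside : ∀ t → m ≢ block i t
    outside t m≡ = ∉ (t , sym m≡)
    m≢i = outside zero
    pm≢i : partner m ≢ i
    pm≢i = outside (suc zero) ∘ partner-swap
    W≢0 = W-off-block i m m≢i (outside (suc zero)) (outside (suc (suc zero)))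
    W'≢0 = W-off-block i (partner m) pm≢i
      (λ pm≡pi → m≢i (trans (partner-swap pm≡pi) (partner-involutive i)))
      (outside (suc (suc (suc zero))) ∘ partner-swap)

  order≤12 : n ≤ 12
  order≤12 = classes-in-blocks⇒order≤ colour block same-colour⇒in-block

  4∣order : 4 ∣ n
  4∣order = ODProperties.full-weight⇒4∣order {C = H₁.H} {c = 1 ∷ 1 ∷ 1 ∷ (n ∸ 3) ∷ []} H₁.H-od
              (quadForm-full 3≤n) 3≤n

small-multiple-of-4 : ∀ {n} → 4 ∣ n → 1 ≤ n → n ≤ 12 → n ≢ 4 → n ≢ 8 → n ≢ 12 → ⊥
small-multiple-of-4 (divides 0 refl) ()
small-multiple-of-4 (divides 1 refl) _ _ n≢4 _   _    = n≢4 refl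
small-multiple-of-4 (divides 2 refl) _ _ _   n≢8 _    = n≢8 refl
small-multiple-of-4 (divides 3 refl) _ _ _   _   n≢12 = n≢12 refl
small-multiple-of-4 (divides (suc (suc (suc (suc q)))) refl) _ n≤12 _ _ _ =
  ℕₚ.≤⇒≯ n≤12 (ℕₚ.m≤m+n 13 (3 ℕ.+ q ℕ.* 4))

theorem2p6 : (n : ℕ) → 1 ≤ n → n ≢ 4 → n ≢ 8 → n ≢ 12 →
    ¬ PD n (1 ∷ 1 ∷ 1 ∷ []) (1 ∷ 1 ∷ 1 ∷ []) ((n ∸ 3) ∷ [])
theorem2p6 n 1≤n n≢4 n≢8 n≢12 pd =
  small-multiple-of-4 4∣order 1≤n order≤12 n≢4 n≢8 n≢12
  where
  3≤n : 3 ≤ n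
  3≤n = ODProperties.weight≤order {C = PD.M₁ pd} {c = 1 ∷ 1 ∷ 1 ∷ []} (PD.M₁-OD pd)
          ones-trit refl (fromℕ< 1≤n)
  open ProductDesign pd 3≤n
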